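{- For any graph $G$, $\textnormal{ftdim}(G)=2$ if and only if $G$ has order at least $2$, at most $2$ connected components, at most $1$ connected component of size at least $2$, and every connected component is a singleton or a path.
   Context: Graphs are finite, simple, undirected, possibly disconnected; $\textnormal{dist}(u,v)=\infty$ between different components. A set $S=\{v_1,\dots,v_k\}$ of vertices is a resolving set of $G$ if the vectors $(\textnormal{dist}(u,v_1),\dots,\textnormal{dist}(u,v_k))$ are pairwise distinct over $u\in V(G)$. $\textnormal{ftdim}(G)$ is the minimum size of a nonempty $S\subseteq V(G)$ such that $S-\{s\}$ is a resolving set for every $s\in S$. -}

module Defs where

open import Data.Nat using (ℕ; zero; suc; _+_; _≤_)
open import Data.Bool using (Bool; true; false; if_then_else_; _∧_)
open import Data.Maybe using (Maybe; just; nothing)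
open import Data.Fin using (Fin; toℕ; _≟_)
open import Data.Fin.Subset using (Subset; _∈_; _-_; ∣_∣; Nonempty)
open import Data.List using (List; allFin)
open import Data.Bool.ListAction using (any)
open import Data.Product using (Σ; ∃; _×_; _,_)
open import Data.Sum using (_⊎_)
open import Relation.Nullary using (¬_)
open import Relation.Nullary.Decidable using (⌊_⌋)
open import Relation.Binary.PropositionalEquality using (_≡_; _≢_)
open import Function.Definitions using (Injective)

record Graph (n : ℕ) : Set where
  field
    adj    : Fin n → Fin n → Bool
    sym    : ∀ i j → adj i j ≡ adj j i
    irrefl : ∀ i → adj i i ≡ false
open Graph public

module _ {n : ℕ} (G : Graph n) where

  reach : ℕ → Fin n → Fin n → Bool
  reach zero    u v = ⌊ u ≟ v ⌋
  reach (suc k) u v = any (λ w → adj G u w ∧ reach k w v) (allFin n)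

  firstReach : ℕ → ℕ → Fin n → Fin n → Maybe ℕ
  firstReach zero     start u v = nothing
  firstReach (suc f)  start u v =
    if reach start u v then just start else firstReach f (suc start) u v

  -- distance: length of a shortest walk (= shortest path, length < n);
  -- nothing encodes ∞ (different components)
  dist : Fin n → Fin n → Maybe ℕ
  dist u v = firstReach n 0 u v

  Connected : Fin n → Fin n → Set
  Connected u v = ∃ λ k → dist u v ≡ just k

  Resolving : Subset n → Set
  Resolving T = ∀ u w → (∀ t → t ∈ T → dist u t ≡ dist w t) → u ≡ w

  FaultTolerantResolving : Subset n → Set
  FaultTolerantResolving S = Nonempty S × (∀ s → s ∈ S → Resolving (S - s))

  FtdimIs : ℕ → Set
  FtdimIs k = (Σ (Subset n) λ S → FaultTolerantResolving S × ∣ S ∣ ≡ k)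
            × (∀ S → FaultTolerantResolving S → k ≤ ∣ S ∣)

  AtMostTwoComponents : Set
  AtMostTwoComponents =
    ¬ (Σ (Fin n) λ a → Σ (Fin n) λ b → Σ (Fin n) λ c →
         ¬ Connected a b × ¬ Connected a c × ¬ Connected b c)

  NontrivialComponent : Fin n → Set
  NontrivialComponent u = Σ (Fin n) λ u' → u' ≢ u × Connected u u'

  AtMostOneNontrivialComponent : Set
  AtMostOneNontrivialComponent =
    ∀ u w → NontrivialComponent u → NontrivialComponent w → Connected u w

  ComponentIsPath : Fin n → Set
  ComponentIsPath x =
    Σ ℕ λ m → Σ (Fin m → Fin n) λ f →
      Injective _≡_ _≡_ f
      × (∀ y → Connected x y → Σ (Fin m) λ i → f i ≡ y)
      × (∀ i → Connected x (f i))
      × (∀ i j → adj G (f i) (f j) ≡ true → (suc (toℕ i) ≡ toℕ j ⊎ suc (toℕ j) ≡ toℕ i))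
      × (∀ i j → (suc (toℕ i) ≡ toℕ j ⊎ suc (toℕ j) ≡ toℕ i) → adj G (f i) (f j) ≡ true)

  ComponentIsSingleton : Fin n → Set
  ComponentIsSingleton x = ∀ y → Connected x y → y ≡ x

  EveryComponentSingletonOrPath : Set
  EveryComponentSingletonOrPath = ∀ x → ComponentIsSingleton x ⊎ ComponentIsPath x

module Submission where

-- ftdim(G) = 2 exactly when two distinct vertices a, b each resolve G on their own: a
-- fault-tolerant resolving set of size 2 is {a, b} with {a} and {b} resolving, and once
-- G has two vertices no set of size at most 1 is fault tolerant, since ∅ resolves nothing.
-- A single resolving vertex a forces the structure. All vertices outside the component of
-- a are at distance ∞ from a, so there is at most one of them; inside it, distances to a
-- are injective and every distance below the eccentricity is attained (a shortest walk
-- passes through all smaller distances), so listing the component by distance to a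
-- gives a path. Conversely, along a path the distance to an end vertex is the position,
-- so both ends resolve G; and if every component is a singleton, G has exactly two
-- vertices and each resolves it.

open import Defs hiding (sym)
open import Data.Bool using (true; false; T)
open import Data.Bool.Properties using (T-≡; T-∧)
open import Data.Empty using (⊥-elim)
open import Data.Fin as Fin using (Fin; zero; suc; toℕ; fromℕ; fromℕ<)
import Data.Fin.Properties as Finₚ
open import Data.Fin.Subset using (Subset; _∈_; _∉_; _-_; _∪_; ⁅_⁆; ∣_∣; ⊥; inside; outside)
open import Data.Fin.Subset.Properties
  using (p─⊥≡p; ∪-identityˡ; ∪-identityʳ; ∣⁅x⁆∣≡1; Empty-unique; x∈⁅x⁆; x∈⁅y⁆⇒x≡y; ∉⊥;
         x∈p∪q⁺; x∈p∪q⁻; p─q⊆p; x∈p∧x≢y⇒x∈p-y)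
open import Data.List using (allFin)
open import Data.List.Membership.Propositional using (lose)
open import Data.List.Membership.Propositional.Properties using (∈-allFin)
open import Data.List.Relation.Unary.Any using (satisfied)
open import Data.List.Relation.Unary.Any.Properties using (any⁺; any⁻)
open import Data.Maybe using (just; nothing)
open import Data.Maybe.Properties using (just-injective)
import Data.Maybe.Properties as Maybeₚ
import Data.Nat as ℕ
open import Data.Nat using (ℕ; zero; suc; pred; _+_; _∸_; _≤_; _<_; z≤n; s≤s; s≤s⁻¹; _<?_; _≤?_)
open import Data.Nat.Induction using (<-rec)
open import Data.Nat.Properties
  using (_≟_; +-comm; +-suc; +-identityʳ; +-monoˡ-<; m+[n∸m]≡n; ∸-cancelˡ-≡; m≤m+n;
         ≤-reflexive; ≤-antisym; ≤-total; ≤-<-trans; <-irrefl; <-cmp; <⇒≱; ≮⇒≥; ≰⇒>; m≤n⇒m<n∨m≡n;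
         ∣n-n∣≡0; ∣-∣-comm; ∣-∣-identityʳ; ∣-∣-triangle; m≤n⇒∣m-n∣≡n∸m; m≤n⇒∣n-m∣≡n∸m; module ≤-Reasoning)
open import Data.Product using (∃; ∃₂; _×_; _,_; proj₁; proj₂)
open import Data.Sum using (_⊎_; inj₁; inj₂)
open import Data.Vec using (_∷_; here; there)
open import Function using (_∘_; case_of_)
open import Function.Definitions using (Injective)
open import Function.Bundles using (_⇔_; mk⇔; Equivalence)
open import Relation.Binary.Definitions using (tri<; tri≈; tri>)
open import Relation.Binary.PropositionalEquality
  using (_≡_; _≢_; refl; sym; trans; cong; subst; module ≡-Reasoning)
open import Relation.Nullary using (¬_; Dec; yes; no; contradiction; ¬?; _×-dec_)
open import Relation.Nullary.Decidable using (toWitness; fromWitness)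
open import Relation.Unary using (Decidable)

private variable
  n : ℕ

suc∣p-x∣≡∣p∣ : {p : Subset n} {x : Fin n} → x ∈ p → suc ∣ (p - x) ∣ ≡ ∣ p ∣
suc∣p-x∣≡∣p∣ {p = _ ∷ p}       here        = cong (λ q → suc ∣ q ∣) (p─⊥≡p p)
suc∣p-x∣≡∣p∣ {p = inside ∷ p}  (there x∈p) = cong suc (suc∣p-x∣≡∣p∣ x∈p)
suc∣p-x∣≡∣p∣ {p = outside ∷ p} (there x∈p) = suc∣p-x∣≡∣p∣ x∈p

∣p∣≡0⇒p≡⊥ : {p : Subset n} → ∣ p ∣ ≡ 0 → p ≡ ⊥
∣p∣≡0⇒p≡⊥ ∣p∣≡0 = Empty-unique λ (x , x∈p) → case trans (suc∣p-x∣≡∣p∣ x∈p) ∣p∣≡0 of λ ()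

∣p∣≡1⇒p≡⁅x⁆ : {p : Subset n} → ∣ p ∣ ≡ 1 → ∃ λ x → p ≡ ⁅ x ⁆
∣p∣≡1⇒p≡⁅x⁆ {p = inside ∷ p}  eq = zero , cong (inside ∷_) (∣p∣≡0⇒p≡⊥ (cong pred eq))
∣p∣≡1⇒p≡⁅x⁆ {p = outside ∷ p} eq with ∣p∣≡1⇒p≡⁅x⁆ {p = p} eq
... | x , refl = suc x , refl

x∉p-x : {p : Subset n} {x : Fin n} → x ∉ p - x
x∉p-x {p = _ ∷ p} {zero}  ()
x∉p-x {p = _ ∷ p} {suc x} (there x∈p-x) = x∉p-x x∈p-x

∣p∣≡2⇒p-x≡⁅y⁆ : {p : Subset n} {x : Fin n} → ∣ p ∣ ≡ 2 → x ∈ p → ∃ λ y → p - x ≡ ⁅ y ⁆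
∣p∣≡2⇒p-x≡⁅y⁆ ∣p∣≡2 x∈p = ∣p∣≡1⇒p≡⁅x⁆ (cong pred (trans (suc∣p-x∣≡∣p∣ x∈p) ∣p∣≡2))

∣⁅x⁆∪⁅y⁆∣≡2 : {x y : Fin n} → x ≢ y → ∣ ⁅ x ⁆ ∪ ⁅ y ⁆ ∣ ≡ 2
∣⁅x⁆∪⁅y⁆∣≡2 {x = zero}  {zero}  x≢y = contradiction refl x≢y
∣⁅x⁆∪⁅y⁆∣≡2 {x = zero}  {suc y} _   = cong suc (trans (cong ∣_∣ (∪-identityˡ ⁅ y ⁆)) (∣⁅x⁆∣≡1 y))
∣⁅x⁆∪⁅y⁆∣≡2 {x = suc x} {zero}  _   = cong suc (trans (cong ∣_∣ (∪-identityʳ ⁅ x ⁆)) (∣⁅x⁆∣≡1 x))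
∣⁅x⁆∪⁅y⁆∣≡2 {x = suc x} {suc y} x≢y = ∣⁅x⁆∪⁅y⁆∣≡2 (λ x≡y → x≢y (cong suc x≡y))

2≤n⇒distinct : 2 ≤ n → ∃₂ λ (a b : Fin n) → a ≢ b
2≤n⇒distinct (s≤s (s≤s z≤n)) = zero , suc zero , λ ()

distinct⇒2≤n : {a b : Fin n} → a ≢ b → 2 ≤ n
distinct⇒2≤n {suc zero}    {zero} {zero} a≢b = contradiction refl a≢b
distinct⇒2≤n {suc (suc n)} _                 = s≤s (s≤s z≤n)

∣n-1+n∣≡1 : ∀ k → ℕ.∣ k - suc k ∣ ≡ 1
∣n-1+n∣≡1 zero    = refl
∣n-1+n∣≡1 (suc k) = ∣n-1+n∣≡1 k

discrete-ivt : ∀ {p} {P : ℕ → Set p} {k} → Decidable P → P 0 → ¬ P k → ∃ λ m → P m × ¬ P (suc m)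
discrete-ivt {k = zero}  P? P0 ¬Pk = contradiction P0 ¬Pk
discrete-ivt {k = suc k} P? P0 ¬Pk with P? k
... | yes Pk  = k , Pk , ¬Pk
... | no  ¬Pk′ = discrete-ivt P? P0 ¬Pk′

module Walks (G : Graph n) where

  infixr 5 _∷_
  data Walk : ℕ → Fin n → Fin n → Set where
    []  : ∀ {u} → Walk 0 u u
    _∷_ : ∀ {k u v w} → adj G u v ≡ true → Walk k v w → Walk (suc k) u w

  private variable
    j k d d′ : ℕ
    u v w : Fin n

  adj-sym : adj G u v ≡ true → adj G v u ≡ true
  adj-sym {u} {v} e = trans (Graph.sym G v u) e

  infixr 5 _++_
  _++_ : Walk j u v → Walk k v w → Walk (j + k) u w
  []      ++ q = q
  (e ∷ p) ++ q = e ∷ (p ++ q)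

  reverse : Walk k u v → Walk k v u
  reverse [] = []
  reverse {suc k} {u} {v} (e ∷ p) = subst (λ l → Walk l v u) (+-comm k 1) (reverse p ++ adj-sym e ∷ [])

  reach⇒walk : ∀ k → T (reach G k u v) → Walk k u v
  reach⇒walk zero r = subst (Walk 0 _) (toWitness r) []
  reach⇒walk (suc k) r with w , r′ ← satisfied (any⁻ _ (allFin n) r) =
    let e , r″ = Equivalence.to T-∧ r′ in Equivalence.to T-≡ e ∷ reach⇒walk k r″

  walk⇒reach : Walk k u v → T (reach G k u v)
  walk⇒reach []                  = fromWitness refl
  walk⇒reach (_∷_ {v = w} e p) =
    any⁺ _ (lose (∈-allFin w) (Equivalence.from T-∧ (Equivalence.from T-≡ e , walk⇒reach p)))

  vertexAt : Walk k u v → Fin (suc k) → Fin n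
  vertexAt {u = u} p zero    = u
  vertexAt (e ∷ p) (suc i) = vertexAt p i

  prefix : (p : Walk k u v) (i : Fin (suc k)) → Walk (toℕ i) u (vertexAt p i)
  prefix p       zero    = []
  prefix (e ∷ p) (suc i) = e ∷ prefix p i

  suffix : (p : Walk k u v) (i : Fin (suc k)) → Walk (k ∸ toℕ i) (vertexAt p i) v
  suffix p       zero    = p
  suffix (e ∷ p) (suc i) = suffix p i

  -- A walk visiting more than n vertices repeats one; cut out the closed part.
  shortcut : Walk k u v → n ≤ k → ∃ λ k′ → k′ < k × Walk k′ u v
  shortcut {k} {v = v} p n≤k with i , j , i<j , same ← Finₚ.pigeonhole (s≤s n≤k) (vertexAt p) =
    toℕ i + (k ∸ toℕ j) , shorter , prefix p i ++ subst (λ x → Walk _ x v) (sym same) (suffix p j)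
    where
    shorter : toℕ i + (k ∸ toℕ j) < k
    shorter = subst (toℕ i + (k ∸ toℕ j) <_) (m+[n∸m]≡n (s≤s⁻¹ (Finₚ.toℕ<n j))) (+-monoˡ-< (k ∸ toℕ j) i<j)

  short-walk : Walk k u v → ∃ λ k′ → k′ < n × Walk k′ u v
  short-walk {k} = <-rec (λ k → ∀ {u v} → Walk k u v → ∃ λ k′ → k′ < n × Walk k′ u v) shorten k
    where
    shorten : ∀ k → (∀ {j} → j < k → ∀ {u v} → Walk j u v → ∃ λ k′ → k′ < n × Walk k′ u v) →
              ∀ {u v} → Walk k u v → ∃ λ k′ → k′ < n × Walk k′ u v
    shorten k rec p with k <? n
    ... | yes k<n = k , k<n , p
    ... | no  k≮n with k′ , k′<k , p′ ← shortcut p (≮⇒≥ k≮n) = rec k′<k p′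

  firstReach-just : ∀ f s → firstReach G f s u v ≡ just d →
                    T (reach G d u v) × (∀ {j} → s ≤ j → T (reach G j u v) → d ≤ j)
  firstReach-just {u = u} {v} (suc f) s h with reach G s u v in eq
  firstReach-just (suc f) s refl | true = Equivalence.from T-≡ eq , λ s≤j _ → s≤j
  ... | false with r , least ← firstReach-just f (suc s) h = r , least′
    where
    least′ : s ≤ j → T (reach G j u v) → _ ≤ j
    least′ s≤j r with m≤n⇒m<n∨m≡n s≤j
    ... | inj₁ s<j  = least s<j r
    ... | inj₂ refl = ⊥-elim (subst T eq r)

  firstReach-nothing : ∀ f s → firstReach G f s u v ≡ nothing → s ≤ j → j < s + f → ¬ T (reach G j u v)
  firstReach-nothing zero s h s≤j j<s+0 r = <⇒≱ (subst (_ <_) (+-identityʳ s) j<s+0) s≤j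
  firstReach-nothing {u = u} {v} {j} (suc f) s h s≤j j<s+f r with reach G s u v in eq
  ... | false with m≤n⇒m<n∨m≡n s≤j
  ...   | inj₁ s<j  = firstReach-nothing f (suc s) h s<j (subst (j <_) (+-suc s f) j<s+f) r
  ...   | inj₂ refl = subst T eq r

  Shortest : ℕ → Fin n → Fin n → Set
  Shortest d u v = Walk d u v × (∀ {k} → Walk k u v → d ≤ k)

  dist≡just⇒shortest : dist G u v ≡ just d → Shortest d u v
  dist≡just⇒shortest h with r , least ← firstReach-just n 0 h =
    reach⇒walk _ r , λ p → least z≤n (walk⇒reach p)

  dist≡nothing⇒¬walk : dist G u v ≡ nothing → ¬ Walk k u v
  dist≡nothing⇒¬walk h p with k′ , k′<n , p′ ← short-walk p =
    firstReach-nothing n 0 h z≤n k′<n (walk⇒reach p′)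

  shortest⇒dist≡just : Shortest d u v → dist G u v ≡ just d
  shortest⇒dist≡just {u = u} {v} (p , least) with dist G u v in eq
  ... | nothing = ⊥-elim (dist≡nothing⇒¬walk eq p)
  ... | just d′ with p′ , least′ ← dist≡just⇒shortest eq = cong just (≤-antisym (least′ p) (least p′))

  dist-refl : dist G u u ≡ just 0
  dist-refl = shortest⇒dist≡just ([] , λ _ → z≤n)

  dist<n : dist G u v ≡ just d → d < n
  dist<n h with p , least ← dist≡just⇒shortest h
             with k , k<n , q ← short-walk p = ≤-<-trans (least q) k<n

  walk⇒connected : Walk k u v → Connected G u v
  walk⇒connected {u = u} {v} p with dist G u v in eq
  ... | nothing = ⊥-elim (dist≡nothing⇒¬walk eq p)
  ... | just d  = d , refl

  connected? : ∀ u v → Dec (Connected G u v)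
  connected? u v with dist G u v
  ... | nothing = no λ ()
  ... | just d  = yes (d , refl)

  ¬connected⇒dist≡nothing : ¬ Connected G u v → dist G u v ≡ nothing
  ¬connected⇒dist≡nothing {u} {v} ¬c with dist G u v
  ... | nothing = refl
  ... | just d  = contradiction (d , refl) ¬c

  connected-refl : Connected G u u
  connected-refl = walk⇒connected []

  connected-sym : Connected G u v → Connected G v u
  connected-sym (_ , h) = walk⇒connected (reverse (proj₁ (dist≡just⇒shortest h)))

  connected-trans : Connected G u v → Connected G v w → Connected G u w
  connected-trans (_ , h) (_ , h′) =
    walk⇒connected (proj₁ (dist≡just⇒shortest h) ++ proj₁ (dist≡just⇒shortest h′))

  connected≢disconnected : Connected G u w → ¬ Connected G v w → dist G u w ≢ dist G v w
  connected≢disconnected (_ , h) ¬v~w eq with () ← trans (sym h) (trans eq (¬connected⇒dist≡nothing ¬v~w))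

  connected-via : Connected G u w → Connected G v w → Connected G u v
  connected-via u~w v~w = connected-trans u~w (connected-sym v~w)

  adj⇒connected : adj G u v ≡ true → Connected G u v
  adj⇒connected e = walk⇒connected (e ∷ [])

  dist-adj-≤ : adj G u w ≡ true → dist G u v ≡ just d → dist G w v ≡ just d′ → d ≤ suc d′
  dist-adj-≤ e h h′ = proj₂ (dist≡just⇒shortest h) (e ∷ proj₁ (dist≡just⇒shortest h′))

  geodesic-step : dist G u v ≡ just (suc d) → ∃ λ w → adj G u w ≡ true × dist G w v ≡ just d
  geodesic-step {v = v} h with dist≡just⇒shortest h
  ... | _∷_ {v = w} e p , least = w , e , shortest⇒dist≡just (p , λ q → s≤s⁻¹ (least (e ∷ q)))

module Resolution (G : Graph n) where
  open Walks G

  ResolvingVertex : Fin n → Set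
  ResolvingVertex a = ∀ u w → dist G u a ≡ dist G w a → u ≡ w

  resolving⁅x⁆⇒resolvingVertex : {x : Fin n} → Resolving G ⁅ x ⁆ → ResolvingVertex x
  resolving⁅x⁆⇒resolvingVertex {x} res u w same =
    res u w λ t t∈⁅x⁆ → subst (λ t → dist G u t ≡ dist G w t) (sym (x∈⁅y⁆⇒x≡y x t∈⁅x⁆)) same

  resolvingVertex⇒resolving : {x : Fin n} {T : Subset n} → ResolvingVertex x → x ∈ T → Resolving G T
  resolvingVertex⇒resolving res x∈T u w same = res u w (same _ x∈T)

  ¬resolving⊥ : {u w : Fin n} → u ≢ w → ¬ Resolving G ⊥
  ¬resolving⊥ {u} {w} u≢w res = u≢w (res u w λ t t∈⊥ → ⊥-elim (∉⊥ t∈⊥))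

  ftResolving⇒2≤∣S∣ : {u w : Fin n} {S : Subset n} → u ≢ w → FaultTolerantResolving G S → 2 ≤ ∣ S ∣
  ftResolving⇒2≤∣S∣ {S = S} u≢w ((x , x∈S) , ft) with ∣ (S - x) ∣ in ∣S-x∣
  ... | zero  = contradiction (subst (Resolving G) (∣p∣≡0⇒p≡⊥ ∣S-x∣) (ft x x∈S)) (¬resolving⊥ u≢w)
  ... | suc _ = subst (2 ≤_) (trans (cong suc (sym ∣S-x∣)) (suc∣p-x∣≡∣p∣ x∈S)) (s≤s (s≤s z≤n))

  ftdim≡2⇔twoResolvingVertices :
    FtdimIs G 2 ⇔ (∃₂ λ a b → a ≢ b × ResolvingVertex a × ResolvingVertex b)
  ftdim≡2⇔twoResolvingVertices = mk⇔ fromFtdim toFtdim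
    where
    fromFtdim : FtdimIs G 2 → ∃₂ λ a b → a ≢ b × ResolvingVertex a × ResolvingVertex b
    fromFtdim ((S , ((a , a∈S) , ft) , ∣S∣≡2) , _)
      with b , S-a≡⁅b⁆ ← ∣p∣≡2⇒p-x≡⁅y⁆ ∣S∣≡2 a∈S
      with b∈S-a ← subst (b ∈_) (sym S-a≡⁅b⁆) (x∈⁅x⁆ b)
      with c , S-b≡⁅c⁆ ← ∣p∣≡2⇒p-x≡⁅y⁆ ∣S∣≡2 (p─q⊆p S ⁅ a ⁆ b∈S-a)
      = a , b , a≢b , resolving⁅x⁆⇒resolvingVertex (subst (Resolving G) S-b≡⁅a⁆ (ft b b∈S))
      , resolving⁅x⁆⇒resolvingVertex (subst (Resolving G) S-a≡⁅b⁆ (ft a a∈S))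
      where
      a≢b : a ≢ b
      a≢b refl = x∉p-x b∈S-a
      b∈S : b ∈ S
      b∈S = p─q⊆p S ⁅ a ⁆ b∈S-a
      S-b≡⁅a⁆ : S - b ≡ ⁅ a ⁆
      S-b≡⁅a⁆ = trans S-b≡⁅c⁆ (cong ⁅_⁆ (sym (x∈⁅y⁆⇒x≡y c (subst (a ∈_) S-b≡⁅c⁆ (x∈p∧x≢y⇒x∈p-y a∈S a≢b)))))

    toFtdim : (∃₂ λ a b → a ≢ b × ResolvingVertex a × ResolvingVertex b) → FtdimIs G 2
    toFtdim (a , b , a≢b , res-a , res-b) =
      (⁅ a ⁆ ∪ ⁅ b ⁆ , ((a , a∈S) , ft) , ∣⁅x⁆∪⁅y⁆∣≡2 a≢b) , λ S → ftResolving⇒2≤∣S∣ a≢b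
      where
      a∈S : a ∈ ⁅ a ⁆ ∪ ⁅ b ⁆
      a∈S = x∈p∪q⁺ (inj₁ (x∈⁅x⁆ a))
      b∈S : b ∈ ⁅ a ⁆ ∪ ⁅ b ⁆
      b∈S = x∈p∪q⁺ (inj₂ (x∈⁅x⁆ b))
      ft : ∀ s → s ∈ ⁅ a ⁆ ∪ ⁅ b ⁆ → Resolving G (⁅ a ⁆ ∪ ⁅ b ⁆ - s)
      ft s s∈S with x∈p∪q⁻ ⁅ a ⁆ ⁅ b ⁆ s∈S
      ... | inj₁ s∈⁅a⁆ with refl ← x∈⁅y⁆⇒x≡y a s∈⁅a⁆ =
        resolvingVertex⇒resolving res-b (x∈p∧x≢y⇒x∈p-y b∈S (λ b≡a → a≢b (sym b≡a)))
      ... | inj₂ s∈⁅b⁆ with refl ← x∈⁅y⁆⇒x≡y b s∈⁅b⁆ =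
        resolvingVertex⇒resolving res-a (x∈p∧x≢y⇒x∈p-y a∈S a≢b)

  AtMostOneVertexOutside : Fin n → Set
  AtMostOneVertexOutside z = ∀ {v w} → ¬ Connected G z v → ¬ Connected G z w → v ≡ w

  resolvingVertex-intro : {z : Fin n} →
    (∀ {v w} → Connected G z v → Connected G z w → dist G v z ≡ dist G w z → v ≡ w) →
    AtMostOneVertexOutside z → ResolvingVertex z
  resolvingVertex-intro {z} inComponent outsideComponent v w same with connected? z v | connected? z w
  ... | yes z~v | yes z~w = inComponent z~v z~w same
  ... | yes z~v | no ¬z~w = ⊥-elim (connected≢disconnected (connected-sym z~v) (¬z~w ∘ connected-sym) same)
  ... | no ¬z~v | yes z~w = ⊥-elim (connected≢disconnected (connected-sym z~w) (¬z~v ∘ connected-sym) (sym same))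
  ... | no ¬z~v | no ¬z~w = outsideComponent ¬z~v ¬z~w

module StructureOfResolvingVertex (G : Graph n) (a : Fin n) (res : Resolution.ResolvingVertex G a) where
  open Walks G

  private variable
    i j d : ℕ
    u v w x : Fin n

  outside-unique : ¬ Connected G u a → ¬ Connected G w a → u ≡ w
  outside-unique ¬u~a ¬w~a = res _ _ (trans (¬connected⇒dist≡nothing ¬u~a) (sym (¬connected⇒dist≡nothing ¬w~a)))

  outside-connected : ¬ Connected G u a → ¬ Connected G w a → Connected G u w
  outside-connected ¬u~a ¬w~a = subst (Connected G _) (outside-unique ¬u~a ¬w~a) connected-refl

  atMostTwoComponents : AtMostTwoComponents G
  atMostTwoComponents (x , y , z , ¬x~y , ¬x~z , ¬y~z) with connected? x a | connected? y a | connected? z a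
  ... | yes x~a | yes y~a | _       = ¬x~y (connected-via x~a y~a)
  ... | yes x~a | _       | yes z~a = ¬x~z (connected-via x~a z~a)
  ... | _       | yes y~a | yes z~a = ¬y~z (connected-via y~a z~a)
  ... | no ¬x~a | no ¬y~a | _       = ¬x~y (outside-connected ¬x~a ¬y~a)
  ... | no ¬x~a | _       | no ¬z~a = ¬x~z (outside-connected ¬x~a ¬z~a)
  ... | _       | no ¬y~a | no ¬z~a = ¬y~z (outside-connected ¬y~a ¬z~a)

  nontrivial⇒connected-to-a : NontrivialComponent G u → Connected G u a
  nontrivial⇒connected-to-a {u} (u′ , u′≢u , u~u′) with connected? u a
  ... | yes u~a = u~a
  ... | no ¬u~a = contradiction (outside-unique (¬u~a ∘ connected-trans u~u′) ¬u~a) u′≢u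

  atMostOneNontrivialComponent : AtMostOneNontrivialComponent G
  atMostOneNontrivialComponent u w u-nontrivial w-nontrivial =
    connected-via (nontrivial⇒connected-to-a u-nontrivial) (nontrivial⇒connected-to-a w-nontrivial)

  Layer : ℕ → Set
  Layer i = ∃ λ v → dist G v a ≡ just i

  layer? : Decidable Layer
  layer? i = Finₚ.any? λ v → Maybeₚ.≡-dec _≟_ (dist G v a) (just i)

  layer-≤ : i ≤ j → Layer j → Layer i
  layer-≤ {j = zero} z≤n layer = layer
  layer-≤ {i} {suc j} i≤1+j (v , h) with m≤n⇒m<n∨m≡n i≤1+j
  ... | inj₁ i<1+j = let w , _ , h′ = geodesic-step h in layer-≤ (s≤s⁻¹ i<1+j) (w , h′)
  ... | inj₂ refl  = v , h

  eccentricity : ∃ λ e → Layer e × ¬ Layer (suc e)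
  eccentricity = discrete-ivt layer? (a , dist-refl) λ (_ , h) → <-irrefl refl (dist<n h)

  ecc : ℕ
  ecc = proj₁ eccentricity

  layer⇒≤ecc : Layer i → i ≤ ecc
  layer⇒≤ecc {i} layer with i ≤? ecc
  ... | yes i≤ecc = i≤ecc
  ... | no  i≰ecc = contradiction (layer-≤ (≰⇒> i≰ecc) layer) (proj₂ (proj₂ eccentricity))

  vertexOnLayer : Fin (suc ecc) → Fin n
  vertexOnLayer i = proj₁ (layer-≤ (s≤s⁻¹ (Finₚ.toℕ<n i)) (proj₁ (proj₂ eccentricity)))

  dist-vertexOnLayer : ∀ i → dist G (vertexOnLayer i) a ≡ just (toℕ i)
  dist-vertexOnLayer i = proj₂ (layer-≤ (s≤s⁻¹ (Finₚ.toℕ<n i)) (proj₁ (proj₂ eccentricity)))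

  same-layer⇒≡ : dist G u a ≡ just i → dist G w a ≡ just i → u ≡ w
  same-layer⇒≡ hu hw = res _ _ (trans hu (sym hw))

  adjacent⇒consecutive-layers : adj G u w ≡ true → dist G u a ≡ just i → dist G w a ≡ just j →
                                suc i ≡ j ⊎ suc j ≡ i
  adjacent⇒consecutive-layers {u} {w} {i} {j} edge hu hw with <-cmp i j
  ... | tri< i<j _ _ = inj₁ (≤-antisym i<j (dist-adj-≤ (adj-sym edge) hw hu))
  ... | tri> _ _ j<i = inj₂ (≤-antisym j<i (dist-adj-≤ edge hu hw))
  ... | tri≈ _ refl _ with refl ← same-layer⇒≡ hu hw = case trans (sym edge) (irrefl G u) of λ ()

  consecutive-layers⇒adjacent : dist G u a ≡ just (suc i) → dist G w a ≡ just i → adj G u w ≡ true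
  consecutive-layers⇒adjacent {u} hu hw with w′ , edge , hw′ ← geodesic-step hu =
    subst (λ v → adj G u v ≡ true) (same-layer⇒≡ hw′ hw) edge

  component-of-a-isPath : Connected G x a → ComponentIsPath G x
  component-of-a-isPath {x} x~a =
    suc ecc , vertexOnLayer , injective , covers , inComponent , adjacent⇒consecutive , consecutive⇒adjacent
    where
    f : Fin (suc ecc) → Fin n
    f = vertexOnLayer
    injective : ∀ {i j} → f i ≡ f j → i ≡ j
    injective {i} {j} fi≡fj = Finₚ.toℕ-injective (just-injective
      (trans (sym (dist-vertexOnLayer i)) (trans (cong (λ v → dist G v a) fi≡fj) (dist-vertexOnLayer j))))
    covers : ∀ y → Connected G x y → ∃ λ i → f i ≡ y
    covers y x~y with d , h ← connected-trans (connected-sym x~y) x~a =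
      fromℕ< (s≤s (layer⇒≤ecc (y , h))) ,
      same-layer⇒≡ (trans (dist-vertexOnLayer _) (cong just (Finₚ.toℕ-fromℕ< _))) h
    inComponent : ∀ i → Connected G x (f i)
    inComponent i = connected-via x~a (_ , dist-vertexOnLayer i)
    adjacent⇒consecutive : ∀ i j → adj G (f i) (f j) ≡ true → suc (toℕ i) ≡ toℕ j ⊎ suc (toℕ j) ≡ toℕ i
    adjacent⇒consecutive i j edge = adjacent⇒consecutive-layers edge (dist-vertexOnLayer i) (dist-vertexOnLayer j)
    consecutive⇒adjacent : ∀ i j → suc (toℕ i) ≡ toℕ j ⊎ suc (toℕ j) ≡ toℕ i → adj G (f i) (f j) ≡ true
    consecutive⇒adjacent i j (inj₁ 1+i≡j) = adj-sym (consecutive-layers⇒adjacent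
      (trans (dist-vertexOnLayer j) (cong just (sym 1+i≡j))) (dist-vertexOnLayer i))
    consecutive⇒adjacent i j (inj₂ 1+j≡i) = consecutive-layers⇒adjacent
      (trans (dist-vertexOnLayer i) (cong just (sym 1+j≡i))) (dist-vertexOnLayer j)

  everyComponentSingletonOrPath : EveryComponentSingletonOrPath G
  everyComponentSingletonOrPath x with connected? x a
  ... | yes x~a = inj₂ (component-of-a-isPath x~a)
  ... | no ¬x~a = inj₁ λ y x~y → outside-unique (¬x~a ∘ connected-trans x~y) ¬x~a

module PathComponent (G : Graph n) {x : Fin n} {m : ℕ} {f : Fin (suc m) → Fin n}
  (injective : Injective _≡_ _≡_ f)
  (covers : ∀ y → Connected G x y → ∃ λ i → f i ≡ y)
  (inComponent : ∀ i → Connected G x (f i))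
  (adjacent⇒consecutive : ∀ i j → adj G (f i) (f j) ≡ true → suc (toℕ i) ≡ toℕ j ⊎ suc (toℕ j) ≡ toℕ i)
  (consecutive⇒adjacent : ∀ i j → suc (toℕ i) ≡ toℕ j ⊎ suc (toℕ j) ≡ toℕ i → adj G (f i) (f j) ≡ true)
  where
  open Walks G
  open Resolution G

  adjacent⇒∣i-j∣≡1 : ∀ i j → adj G (f i) (f j) ≡ true → ℕ.∣ toℕ i - toℕ j ∣ ≡ 1
  adjacent⇒∣i-j∣≡1 i j e with adjacent⇒consecutive i j e
  ... | inj₁ 1+i≡j = subst (λ k → ℕ.∣ toℕ i - k ∣ ≡ 1) 1+i≡j (∣n-1+n∣≡1 (toℕ i))
  ... | inj₂ 1+j≡i = trans (∣-∣-comm (toℕ i) (toℕ j)) (subst (λ k → ℕ.∣ toℕ j - k ∣ ≡ 1) 1+j≡i (∣n-1+n∣≡1 (toℕ j)))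

  walk-endpoint-index : ∀ {k v} i → Walk k (f i) v → ∃ λ j → f j ≡ v × ℕ.∣ toℕ i - toℕ j ∣ ≤ k
  walk-endpoint-index i [] = i , refl , ≤-reflexive (∣n-n∣≡0 (toℕ i))
  walk-endpoint-index {suc k} {v} i (_∷_ {v = w} e p)
    with l , refl ← covers w (connected-trans (inComponent i) (adj⇒connected e))
    with j , fj≡v , ∣l-j∣≤k ← walk-endpoint-index l p =
    j , fj≡v , (begin
      ℕ.∣ toℕ i - toℕ j ∣                     ≤⟨ ∣-∣-triangle (toℕ i) (toℕ l) (toℕ j) ⟩
      ℕ.∣ toℕ i - toℕ l ∣ + ℕ.∣ toℕ l - toℕ j ∣ ≡⟨ cong (_+ ℕ.∣ toℕ l - toℕ j ∣) (adjacent⇒∣i-j∣≡1 i l e) ⟩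
      suc ℕ.∣ toℕ l - toℕ j ∣                 ≤⟨ s≤s ∣l-j∣≤k ⟩
      suc k                                 ∎)
    where open ≤-Reasoning

  walk-along-path : ∀ d i j → toℕ i + d ≡ toℕ j → Walk d (f i) (f j)
  walk-along-path zero i j i+0≡j =
    subst (λ j → Walk 0 (f i) (f j)) (Finₚ.toℕ-injective (trans (sym (+-identityʳ _)) i+0≡j)) []
  walk-along-path (suc d) i j i+1+d≡j =
    consecutive⇒adjacent i i′ (inj₁ (sym (Finₚ.toℕ-fromℕ< 1+i<1+m))) ∷ walk-along-path d i′ j i′+d≡j
    where
    1+i+d≡j : suc (toℕ i + d) ≡ toℕ j
    1+i+d≡j = trans (sym (+-suc (toℕ i) d)) i+1+d≡j
    1+i<1+m : suc (toℕ i) < suc m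
    1+i<1+m = ≤-<-trans (s≤s (m≤m+n (toℕ i) d)) (subst (_< suc m) (sym 1+i+d≡j) (Finₚ.toℕ<n j))
    i′ : Fin (suc m)
    i′ = fromℕ< 1+i<1+m
    i′+d≡j : toℕ i′ + d ≡ toℕ j
    i′+d≡j = trans (cong (_+ d) (Finₚ.toℕ-fromℕ< 1+i<1+m)) 1+i+d≡j

  dist-along-path : ∀ i j → dist G (f i) (f j) ≡ just ℕ.∣ toℕ i - toℕ j ∣
  dist-along-path i j = shortest⇒dist≡just (walk , minimal)
    where
    walk : Walk ℕ.∣ toℕ i - toℕ j ∣ (f i) (f j)
    walk with ≤-total (toℕ i) (toℕ j)
    ... | inj₁ i≤j = subst (λ d → Walk d (f i) (f j)) (sym (m≤n⇒∣m-n∣≡n∸m i≤j))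
                           (walk-along-path _ i j (m+[n∸m]≡n i≤j))
    ... | inj₂ j≤i = subst (λ d → Walk d (f i) (f j)) (sym (m≤n⇒∣n-m∣≡n∸m j≤i))
                           (reverse (walk-along-path _ j i (m+[n∸m]≡n j≤i)))
    minimal : ∀ {k} → Walk k (f i) (f j) → ℕ.∣ toℕ i - toℕ j ∣ ≤ k
    minimal p with l , fl≡fj , ∣i-l∣≤k ← walk-endpoint-index i p with refl ← injective fl≡fj = ∣i-l∣≤k

  vertex-resolves : ∀ z → (∀ {i j} → ℕ.∣ toℕ i - toℕ z ∣ ≡ ℕ.∣ toℕ j - toℕ z ∣ → i ≡ j) →
    AtMostOneVertexOutside x → ResolvingVertex (f z)
  vertex-resolves z separates outside-unique = resolvingVertex-intro sameComponent otherComponent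
    where
    sameComponent : ∀ {v w} → Connected G (f z) v → Connected G (f z) w → dist G v (f z) ≡ dist G w (f z) → v ≡ w
    sameComponent fz~v fz~w same
      with i , refl ← covers _ (connected-trans (inComponent z) fz~v)
      with j , refl ← covers _ (connected-trans (inComponent z) fz~w) =
      cong f (separates (just-injective (trans (sym (dist-along-path i z)) (trans same (dist-along-path j z)))))
    otherComponent : AtMostOneVertexOutside (f z)
    otherComponent ¬fz~v ¬fz~w = outside-unique (¬fz~v ∘ leave) (¬fz~w ∘ leave)
      where
      leave : ∀ {v} → Connected G x v → Connected G (f z) v
      leave = connected-trans (connected-sym (inComponent z))

  first-vertex-resolves : AtMostOneVertexOutside x → ResolvingVertex (f zero)
  first-vertex-resolves = vertex-resolves zero λ {i} {j} eq →
    Finₚ.toℕ-injective (trans (sym (∣-∣-identityʳ (toℕ i))) (trans eq (∣-∣-identityʳ (toℕ j))))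

  last-vertex-resolves : AtMostOneVertexOutside x → ResolvingVertex (f (fromℕ m))
  last-vertex-resolves = vertex-resolves (fromℕ m) λ {i} {j} eq →
    Finₚ.toℕ-injective (∸-cancelˡ-≡ (i≤m i) (i≤m j) (begin
      m ∸ toℕ i                  ≡⟨ m≤n⇒∣m-n∣≡n∸m (i≤m i) ⟨
      ℕ.∣ toℕ i - m ∣              ≡⟨ cong ℕ.∣ toℕ i -_∣ (Finₚ.toℕ-fromℕ m) ⟨
      ℕ.∣ toℕ i - toℕ (fromℕ m) ∣ ≡⟨ eq ⟩
      ℕ.∣ toℕ j - toℕ (fromℕ m) ∣ ≡⟨ cong ℕ.∣ toℕ j -_∣ (Finₚ.toℕ-fromℕ m) ⟩
      ℕ.∣ toℕ j - m ∣              ≡⟨ m≤n⇒∣m-n∣≡n∸m (i≤m j) ⟩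
      m ∸ toℕ j                  ∎))
    where
    open ≡-Reasoning
    i≤m : ∀ (i : Fin (suc m)) → toℕ i ≤ m
    i≤m i = s≤s⁻¹ (Finₚ.toℕ<n i)

module StructureGivesResolvingVertices (G : Graph n)
  (atMostTwo : AtMostTwoComponents G) (atMostOneNontrivial : AtMostOneNontrivialComponent G) where
  open Walks G
  open Resolution G

  private variable
    v w z : Fin n

  outsiders-nontrivial : ¬ Connected G z v → ¬ Connected G z w → v ≢ w → NontrivialComponent G v
  outsiders-nontrivial {z} {v} {w} ¬z~v ¬z~w v≢w with connected? v w
  ... | yes v~w = w , v≢w ∘ sym , v~w
  ... | no ¬v~w = ⊥-elim (atMostTwo (z , v , w , ¬z~v , ¬z~w , ¬v~w))

  outside-nontrivial-unique : NontrivialComponent G z → AtMostOneVertexOutside z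
  outside-nontrivial-unique {z} z-nontrivial {v} {w} ¬z~v ¬z~w with v Fin.≟ w
  ... | yes v≡w = v≡w
  ... | no  v≢w = ⊥-elim (¬z~v (atMostOneNontrivial z v z-nontrivial (outsiders-nontrivial ¬z~v ¬z~w v≢w)))

  all-trivial⇒resolvingVertex : (∀ u → ¬ NontrivialComponent G u) → ResolvingVertex z
  all-trivial⇒resolvingVertex {z} trivial = resolvingVertex-intro
    (λ z~v z~w _ → trans (isolated z~v) (sym (isolated z~w)))
    λ {v} {w} ¬z~v ¬z~w → case v Fin.≟ w of λ where
      (yes v≡w) → v≡w
      (no v≢w)  → ⊥-elim (trivial v (outsiders-nontrivial ¬z~v ¬z~w v≢w))
    where
    isolated : Connected G z v → v ≡ z
    isolated {v} z~v with v Fin.≟ z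
    ... | yes v≡z = v≡z
    ... | no  v≢z = ⊥-elim (trivial z (v , v≢z , z~v))

  nontrivial? : ∀ u → Dec (NontrivialComponent G u)
  nontrivial? u = Finₚ.any? λ u′ → ¬? (u′ Fin.≟ u) ×-dec connected? u u′

  twoResolvingVertices : 2 ≤ n → EveryComponentSingletonOrPath G →
                         ∃₂ λ a b → a ≢ b × ResolvingVertex a × ResolvingVertex b
  twoResolvingVertices 2≤n singletonOrPath with Finₚ.any? nontrivial?
  ... | no none with a , b , a≢b ← 2≤n⇒distinct 2≤n =
    a , b , a≢b , all-trivial⇒resolvingVertex trivial , all-trivial⇒resolvingVertex trivial
    where
    trivial : ∀ u → ¬ NontrivialComponent G u
    trivial u u-nontrivial = none (u , u-nontrivial)
  ... | yes (x , x-nontrivial@(x′ , x′≢x , x~x′)) with singletonOrPath x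
  ...   | inj₁ singleton = contradiction (singleton x′ x~x′) x′≢x
  ...   | inj₂ (zero , f , _ , covers , _) with () ← proj₁ (covers x connected-refl)
  ...   | inj₂ (suc zero , f , _ , covers , _)
          with zero , f0≡x ← covers x connected-refl
          with zero , f0≡x′ ← covers x′ x~x′ = contradiction (trans (sym f0≡x′) f0≡x) x′≢x
  ...   | inj₂ (suc (suc m) , f , injective , covers , inComponent , adjacent⇒consecutive , consecutive⇒adjacent) =
    f zero , f (fromℕ (suc m)) , (λ f0≡fm → case injective f0≡fm of λ ()) ,
    first-vertex-resolves outside-unique , last-vertex-resolves outside-unique
    where
    open PathComponent G injective covers inComponent adjacent⇒consecutive consecutive⇒adjacent
    outside-unique : AtMostOneVertexOutside x
    outside-unique = outside-nontrivial-unique x-nontrivial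

theorem3 : ∀ (n : ℕ) (G : Graph n) →
    FtdimIs G 2 ⇔ (2 ≤ n × AtMostTwoComponents G × AtMostOneNontrivialComponent G × EveryComponentSingletonOrPath G)
theorem3 n G = mk⇔ structure resolvers
  where
  open Resolution G
  open Equivalence ftdim≡2⇔twoResolvingVertices

  structure : FtdimIs G 2 → 2 ≤ n × AtMostTwoComponents G × AtMostOneNontrivialComponent G × EveryComponentSingletonOrPath G
  structure ftdim≡2 with a , _ , a≢b , res-a , _ ← to ftdim≡2 =
    distinct⇒2≤n a≢b , atMostTwoComponents , atMostOneNontrivialComponent , everyComponentSingletonOrPath
    where open StructureOfResolvingVertex G a res-a

  resolvers : 2 ≤ n × AtMostTwoComponents G × AtMostOneNontrivialComponent G × EveryComponentSingletonOrPath G → FtdimIs G 2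
  resolvers (2≤n , atMostTwo , atMostOneNontrivial , singletonOrPath) =
    from (StructureGivesResolvingVertices.twoResolvingVertices G atMostTwo atMostOneNontrivial 2≤n singletonOrPath)
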